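{- Let $m \geq 3$. Let $G$ be the graph with vertex set $\mathbb{Z}_m\times\mathbb{Z}_8$ whose edges are: all edges of the Cayley graph $\mathrm{Cay}(\mathbb{Z}_m\times\mathbb{Z}_8,\{(1,4),(-1,4)\})$ (i.e. $\{(i,x),(i\pm1,x+4)\}$); and, for every $i\in\mathbb{Z}_m$, the edges $\{(i,x),(i,y)\}$ for each pair $\{x,y\}\in I_4\cup I_5\cup I_6$, where $I_4=\{\{0,5\},\{1,7\},\{2,4\},\{3,6\}\}$, $I_5=\{\{0,2\},\{1,3\},\{5,7\},\{4,6\}\}$, $I_6=\{\{0,6\},\{1,4\},\{2,7\},\{3,5\}\}$. Then the edge set of $G$ can be partitioned into two $C_8$-factors and one 1-factor.
   Context: For a finite additive group $\Gamma$ and $S\subseteq\Gamma\setminus\{0\}$ with $S=-S$, $\mathrm{Cay}(\Gamma,S)$ has vertex set $\Gamma$ and edges $\{x,y\}$ with $x-y\in S$. A $C_k$-factor of a graph is a spanning subgraph each of whose components is a cycle of length $k$; a 1-factor is a perfect matching. -}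

module Defs where

open import Data.Nat using (ℕ; zero; suc; _≤_; _+_)
open import Data.Nat.DivMod using (_mod_)
open import Data.Fin using (Fin; toℕ)
open import Data.Product using (Σ; ∃; _×_; _,_; proj₁; proj₂)
open import Data.Sum using (_⊎_)
open import Data.List using (List; []; _∷_; _++_)
open import Data.List.Membership.Propositional using (_∈_)
open import Relation.Binary.PropositionalEquality using (_≡_)
open import Relation.Nullary using (¬_)
open import Function.Bundles using (_⤖_; _⇔_; Bijection)

sucMod : ∀ {k} → Fin k → Fin k
sucMod {suc k} i = suc (toℕ i) mod suc k

add4 : Fin 8 → Fin 8
add4 x = (toℕ x + 4) mod 8

V : ℕ → Set
V m = Fin m × Fin 8

CayAdj : (m : ℕ) → V m → V m → Set
CayAdj m (i , x) (j , y) = (y ≡ add4 x) × ((j ≡ sucMod i) ⊎ (i ≡ sucMod j))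

I4 I5 I6 : List (ℕ × ℕ)
I4 = (0 , 5) ∷ (1 , 7) ∷ (2 , 4) ∷ (3 , 6) ∷ []
I5 = (0 , 2) ∷ (1 , 3) ∷ (5 , 7) ∷ (4 , 6) ∷ []
I6 = (0 , 6) ∷ (1 , 4) ∷ (2 , 7) ∷ (3 , 5) ∷ []

InI : Fin 8 → Fin 8 → Set
InI x y = ((toℕ x , toℕ y) ∈ (I4 ++ I5 ++ I6)) ⊎ ((toℕ y , toℕ x) ∈ (I4 ++ I5 ++ I6))

InnerAdj : (m : ℕ) → V m → V m → Set
InnerAdj m (i , x) (j , y) = (i ≡ j) × InI x y

Adj : (m : ℕ) → V m → V m → Set
Adj m u v = CayAdj m u v ⊎ InnerAdj m u v

-- H (a spanning subgraph on vertex set W, given by its adjacency relation)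
-- is a C_k-factor: W is partitioned into t vertex-disjoint k-cycles
-- c j 0, c j 1, …, c j (k-1) (a bijection Fin t × Fin k ⤖ W), and the edges
-- of H are exactly the edges of these cycles.
CFactor : {W : Set} → ℕ → (W → W → Set) → Set
CFactor {W} k H =
  Σ ℕ λ t → Σ ((Fin t × Fin k) ⤖ W) λ c →
    let cyc : Fin t → Fin k → W
        cyc j i = Bijection.to c (j , i)
    in ∀ u v → H u v ⇔
         (Σ (Fin t) λ j → Σ (Fin k) λ i →
            ((u ≡ cyc j i) × (v ≡ cyc j (sucMod i)))
            ⊎ ((v ≡ cyc j i) × (u ≡ cyc j (sucMod i))))

OneFactor : {W : Set} → (W → W → Set) → Set
OneFactor {W} H =
  (∀ u v → H u v → H v u) ×
  (∀ u → Σ W λ v → H u v × (∀ w → H u w → w ≡ v))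

EdgePartition : {W : Set} → (G H₁ H₂ H₃ : W → W → Set) → Set
EdgePartition G H₁ H₂ H₃ = ∀ u v →
  (G u v ⇔ (H₁ u v ⊎ H₂ u v ⊎ H₃ u v)) ×
  ¬ (H₁ u v × H₂ u v) × ¬ (H₁ u v × H₃ u v) × ¬ (H₂ u v × H₃ u v)

-- The graph is invariant under the column translation (i , x) ↦ (i + 1 , x),
-- and each of its edges joins a column i to column i, i + 1 or i − 1.  So we look
-- for factors that repeat in every column: a relation of this kind is given by a
-- table over ℤ_8 recording, for each column offset, which fibre elements are
-- related.  The two C₈-factors are the translates of the cycles
-- 4 2 7 5 | 1 3 6 0 and 6 4 1 7 | 3 5 0 2, whose first four vertices lie in
-- column j and last four in column j + 1; the 1-factor consists of the Cayley
-- edges leaving the vertices x < 4 upwards.  Since m ≥ 3 makes the offsets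
-- 0, 1, −1 distinct, partition and disjointness reduce to finite checks on tables.
module Submission where

open import Defs
open import Data.Bool using (Bool; true; false; if_then_else_)
open import Data.Empty using (⊥-elim)
open import Data.Fin using (Fin; toℕ; #_)
open import Data.Fin.Properties using (toℕ-injective; toℕ-fromℕ<; toℕ<n; all?; any?)
  renaming (_≟_ to _≟ᶠ_)
open import Data.List using (_++_)
import Data.List.Membership.DecPropositional
open import Data.Nat using (ℕ; suc; _+_; _*_; _<_; _≤_; _<ᵇ_; _≤ᵇ_; s≤s; z≤n)
open import Data.Nat.Properties using (+-comm; +-assoc; +-cancelˡ-≡; <-irrefl; ≤-trans; m≤m+n)
  renaming (_≟_ to _≟ℕ_)
open import Data.Nat.DivMod using (_mod_; _%_; _/_; m%n<n; m≡m%n+[m/n]*n; %-distribˡ-+; m%n%n≡m%n; [m+n]%n≡m%n; m<n⇒m%n≡m)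
open import Data.Product using (Σ; _×_; _,_; proj₁; proj₂)
open import Data.Product.Properties using (≡-dec)
open import Data.Sum using (_⊎_; inj₁; inj₂)
open import Data.Vec using (Vec; lookup; []; _∷_)
open import Function.Bundles using (_⇔_; _↔_; mk⇔; mk↔ₛ′; Inverse; module Equivalence)
open import Function.Construct.Composition using (_⇔-∘_)
open import Function.Properties.Inverse using (↔⇒⤖)
open import Relation.Binary.Definitions using (DecidableEquality)
open import Relation.Binary.PropositionalEquality
open import Relation.Nullary using (¬_; Dec; yes; no)
open import Relation.Nullary.Decidable using (True; toWitness; map′; from-yes; _×-dec_; _⊎-dec_; _→-dec_; ¬?)

-- sucMod is definitionally addMod 1.
addMod : ∀ {d} → ℕ → Fin d → Fin d
addMod {suc k} c i = (c + toℕ i) mod suc k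

predMod : ∀ {d} → Fin d → Fin d
predMod {suc k} = addMod k

module _ {k : ℕ} where
  private
    d = suc k

  toℕ-addMod : ∀ c (i : Fin d) → toℕ (addMod c i) ≡ (c + toℕ i) % d
  toℕ-addMod c i = toℕ-fromℕ< (m%n<n (c + toℕ i) d)

  addMod-addMod : ∀ c c′ (i : Fin d) → addMod c (addMod c′ i) ≡ addMod (c + c′) i
  addMod-addMod c c′ i = toℕ-injective (begin
    toℕ (addMod c (addMod c′ i))        ≡⟨ toℕ-addMod c (addMod c′ i) ⟩
    (c + toℕ (addMod c′ i)) % d         ≡⟨ cong (λ n → (c + n) % d) (toℕ-addMod c′ i) ⟩
    (c + (c′ + toℕ i) % d) % d          ≡⟨ %-distribˡ-+ c ((c′ + toℕ i) % d) d ⟩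
    (c % d + (c′ + toℕ i) % d % d) % d  ≡⟨ cong (λ n → (c % d + n) % d) (m%n%n≡m%n (c′ + toℕ i) d) ⟩
    (c % d + (c′ + toℕ i) % d) % d      ≡⟨ %-distribˡ-+ c (c′ + toℕ i) d ⟨
    (c + (c′ + toℕ i)) % d              ≡⟨ cong (_% d) (+-assoc c c′ (toℕ i)) ⟨
    (c + c′ + toℕ i) % d                ≡⟨ toℕ-addMod (c + c′) i ⟨
    toℕ (addMod (c + c′) i)             ∎)
    where open ≡-Reasoning

  addMod-period : ∀ (i : Fin d) → addMod d i ≡ i
  addMod-period i = toℕ-injective (begin
    toℕ (addMod d i)   ≡⟨ toℕ-addMod d i ⟩
    (d + toℕ i) % d    ≡⟨ cong (_% d) (+-comm d (toℕ i)) ⟩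
    (toℕ i + d) % d    ≡⟨ [m+n]%n≡m%n (toℕ i) d ⟩
    toℕ i % d          ≡⟨ m<n⇒m%n≡m (toℕ<n i) ⟩
    toℕ i              ∎)
    where open ≡-Reasoning

  -- Writing c + a = (c + a) % d + q * d, a fixed point would make c a multiple of d.
  addMod-irrefl : ∀ {c} → 0 < c → c < d → (i : Fin d) → addMod c i ≢ i
  addMod-irrefl {c} 0<c c<d i fixed = no-multiple q c≡q*d
    where
      a = toℕ i
      q = (c + a) / d
      c≡q*d : c ≡ q * d
      c≡q*d = +-cancelˡ-≡ a c (q * d) (begin
        a + c                ≡⟨ +-comm a c ⟩
        c + a                ≡⟨ m≡m%n+[m/n]*n (c + a) d ⟩
        (c + a) % d + q * d  ≡⟨ cong (_+ q * d) (trans (sym (toℕ-addMod c i)) (cong toℕ fixed)) ⟩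
        a + q * d            ∎)
        where open ≡-Reasoning
      no-multiple : ∀ q → c ≢ q * d
      no-multiple 0       c≡0   = <-irrefl (sym c≡0) 0<c
      no-multiple (suc q) c≡q*d = <-irrefl refl (≤-trans c<d (subst (d ≤_) (sym c≡q*d) (m≤m+n d (q * d))))

sucMod-predMod : ∀ {d} (i : Fin d) → sucMod (predMod i) ≡ i
sucMod-predMod {suc k} i = trans (addMod-addMod 1 k i) (addMod-period i)

predMod-sucMod : ∀ {d} (i : Fin d) → predMod (sucMod i) ≡ i
predMod-sucMod {suc k} i = begin
  addMod k (addMod 1 i)  ≡⟨ addMod-addMod k 1 i ⟩
  addMod (k + 1) i       ≡⟨ cong (λ c → addMod c i) (+-comm k 1) ⟩
  addMod (suc k) i       ≡⟨ addMod-period i ⟩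
  i                      ∎
  where open ≡-Reasoning

sucMod≢id : ∀ {k} (i : Fin (2 + k)) → sucMod i ≢ i
sucMod≢id i = addMod-irrefl (s≤s z≤n) (s≤s (s≤s z≤n)) i

predMod≢id : ∀ {k} (i : Fin (2 + k)) → predMod i ≢ i
predMod≢id i pred≡i = sucMod≢id i (trans (cong sucMod (sym pred≡i)) (sucMod-predMod i))

sucMod≢predMod : ∀ {k} (i : Fin (3 + k)) → sucMod i ≢ predMod i
sucMod≢predMod i suc≡pred = addMod-irrefl (s≤s z≤n) (s≤s (s≤s (s≤s z≤n))) i (begin
  addMod 2 i             ≡⟨ addMod-addMod 1 1 i ⟨
  sucMod (sucMod i)      ≡⟨ cong sucMod suc≡pred ⟩
  sucMod (predMod i)     ≡⟨ sucMod-predMod i ⟩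
  i                      ∎)
  where open ≡-Reasoning

data Shift : Set where
  stay up down : Shift

_≟ₛ_ : DecidableEquality Shift
stay ≟ₛ stay = yes refl
stay ≟ₛ up   = no λ ()
stay ≟ₛ down = no λ ()
up   ≟ₛ stay = no λ ()
up   ≟ₛ up   = yes refl
up   ≟ₛ down = no λ ()
down ≟ₛ stay = no λ ()
down ≟ₛ up   = no λ ()
down ≟ₛ down = yes refl

all-Shift? : {P : Shift → Set} → (∀ s → Dec (P s)) → Dec (∀ s → P s)
all-Shift? P? = map′ (λ { (p , q , r) → λ { stay → p ; up → q ; down → r } })
                     (λ p → p stay , p up , p down)
                     (P? stay ×-dec P? up ×-dec P? down)

shift : ∀ {m} → Shift → Fin m → Fin m
shift stay i = i
shift up   i = sucMod i
shift down i = predMod i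

reverse : Shift → Shift
reverse stay = stay
reverse up   = down
reverse down = up

reverse-cancelˡ : ∀ {m} s (i : Fin m) → shift (reverse s) (shift s i) ≡ i
reverse-cancelˡ stay i = refl
reverse-cancelˡ up   i = predMod-sucMod i
reverse-cancelˡ down i = sucMod-predMod i

reverse-cancelʳ : ∀ {m} s (i : Fin m) → shift s (shift (reverse s) i) ≡ i
reverse-cancelʳ stay i = refl
reverse-cancelʳ up   i = sucMod-predMod i
reverse-cancelʳ down i = predMod-sucMod i

shift-injective : ∀ {k} s t (i : Fin (3 + k)) → shift s i ≡ shift t i → s ≡ t
shift-injective stay stay i e = refl
shift-injective stay up   i e = ⊥-elim (sucMod≢id i (sym e))
shift-injective stay down i e = ⊥-elim (predMod≢id i (sym e))
shift-injective up   stay i e = ⊥-elim (sucMod≢id i e)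
shift-injective up   up   i e = refl
shift-injective up   down i e = ⊥-elim (sucMod≢predMod i e)
shift-injective down stay i e = ⊥-elim (predMod≢id i e)
shift-injective down up   i e = ⊥-elim (sucMod≢predMod i (sym e))
shift-injective down down i e = refl

Table : Set → Set₁
Table A = Shift → A → A → Set

Periodic : ∀ {m} {A : Set} → Table A → Fin m × A → Fin m × A → Set
Periodic R (i , x) (j , y) = Σ Shift λ s → j ≡ shift s i × R s x y

module _ {A : Set} where

  Periodic-partition : ∀ {m} {R R₁ R₂ R₃ : Table A} →
    (∀ s x y → R s x y ⇔ (R₁ s x y ⊎ R₂ s x y ⊎ R₃ s x y)) →
    ∀ (u v : Fin m × A) → Periodic R u v ⇔ (Periodic R₁ u v ⊎ Periodic R₂ u v ⊎ Periodic R₃ u v)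
  Periodic-partition {R = R} {R₁} {R₂} {R₃} R⇔ u@(i , x) v@(j , y) = mk⇔ split join
    where
      split : Periodic R u v → Periodic R₁ u v ⊎ Periodic R₂ u v ⊎ Periodic R₃ u v
      split (s , e , r) with Equivalence.to (R⇔ s x y) r
      ... | inj₁ r₁        = inj₁ (s , e , r₁)
      ... | inj₂ (inj₁ r₂) = inj₂ (inj₁ (s , e , r₂))
      ... | inj₂ (inj₂ r₃) = inj₂ (inj₂ (s , e , r₃))
      join : Periodic R₁ u v ⊎ Periodic R₂ u v ⊎ Periodic R₃ u v → Periodic R u v
      join (inj₁ (s , e , r₁))        = s , e , Equivalence.from (R⇔ s x y) (inj₁ r₁)
      join (inj₂ (inj₁ (s , e , r₂))) = s , e , Equivalence.from (R⇔ s x y) (inj₂ (inj₁ r₂))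
      join (inj₂ (inj₂ (s , e , r₃))) = s , e , Equivalence.from (R⇔ s x y) (inj₂ (inj₂ r₃))

  -- Needs m ≥ 3: in ℤ_2 the columns i + 1 and i − 1 coincide.
  Periodic-disjoint : ∀ {k} {R₁ R₂ : Table A} → (∀ s x y → ¬ (R₁ s x y × R₂ s x y)) →
    ∀ (u v : Fin (3 + k) × A) → ¬ (Periodic R₁ u v × Periodic R₂ u v)
  Periodic-disjoint disjoint (i , x) (j , y) ((s , refl , r₁) , (t , e , r₂))
    with shift-injective s t i e
  ... | refl = disjoint s x y (r₁ , r₂)

lift : Bool → Shift
lift false = stay
lift true  = up

stepBetween : Bool → Bool → Shift
stepBetween false false = stay
stepBetween false true  = up
stepBetween true  false = down
stepBetween true  true  = stay

shift-stepBetween : ∀ {m} a b (j : Fin m) → shift (stepBetween a b) (shift (lift a) j) ≡ shift (lift b) j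
shift-stepBetween false false j = refl
shift-stepBetween false true  j = refl
shift-stepBetween true  false j = predMod-sucMod j
shift-stepBetween true  true  j = refl

-- The j-th translate of the cycle visits, at position p, the fibre element
-- Inverse.to order p in column j, or in column j + 1 when raised p.
record CyclePattern (k : ℕ) (A : Set) : Set where
  field
    order  : Fin k ↔ A
    raised : Fin k → Bool

module _ {k : ℕ} {A : Set} (P : CyclePattern k A) where
  open CyclePattern P
  open Inverse order using () renaming
    (to to vertex; from to position; strictlyInverseˡ to vertex-position; strictlyInverseʳ to position-vertex)

  step : Fin k → Shift
  step p = stepBetween (raised p) (raised (sucMod p))

  cycleTable : Table A
  cycleTable s x y = Σ (Fin k) λ p →
      (x ≡ vertex p × y ≡ vertex (sucMod p) × s ≡ step p)
    ⊎ (y ≡ vertex p × x ≡ vertex (sucMod p) × s ≡ reverse (step p))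

  cycleTable? : DecidableEquality A → ∀ s x y → Dec (cycleTable s x y)
  cycleTable? _≟_ s x y = any? λ p →
        (x ≟ vertex p ×-dec y ≟ vertex (sucMod p) ×-dec s ≟ₛ step p)
    ⊎-dec (y ≟ vertex p ×-dec x ≟ vertex (sucMod p) ×-dec s ≟ₛ reverse (step p))

  cycle-factor : ∀ {m} → CFactor k (Periodic {m} cycleTable)
  cycle-factor {m} = m , ↔⇒⤖ arrangement , λ u v → mk⇔ (toCycle u v) (fromCycle u v)
    where
      column : Fin k → Fin m → Fin m
      column p = shift (lift (raised p))

      place : Fin m × Fin k → Fin m × A
      place (j , p) = column p j , vertex p

      unplace : Fin m × A → Fin m × Fin k
      unplace (i , x) = shift (reverse (lift (raised (position x)))) i , position x

      place-unplace : ∀ u → place (unplace u) ≡ u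
      place-unplace (i , x) = cong₂ _,_ (reverse-cancelʳ (lift (raised (position x))) i) (vertex-position x)

      unplace-place : ∀ a → unplace (place a) ≡ a
      unplace-place (j , p) rewrite position-vertex p = cong (_, p) (reverse-cancelˡ (lift (raised p)) j)

      arrangement : (Fin m × Fin k) ↔ (Fin m × A)
      arrangement = mk↔ₛ′ place unplace place-unplace unplace-place

      OnCycle : Fin m × A → Fin m × A → Set
      OnCycle u v = Σ (Fin m) λ j → Σ (Fin k) λ p →
          (u ≡ place (j , p) × v ≡ place (j , sucMod p))
        ⊎ (v ≡ place (j , p) × u ≡ place (j , sucMod p))

      shift-step : ∀ p j → shift (step p) (column p j) ≡ column (sucMod p) j
      shift-step p = shift-stepBetween (raised p) (raised (sucMod p))

      shift-step⁻¹ : ∀ p j → shift (reverse (step p)) (column (sucMod p) j) ≡ column p j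
      shift-step⁻¹ p j = trans (cong (shift (reverse (step p))) (sym (shift-step p j)))
                               (reverse-cancelˡ (step p) (column p j))

      fromCycle : ∀ u v → OnCycle u v → Periodic cycleTable u v
      fromCycle _ _ (j , p , inj₁ (refl , refl)) =
        step p , sym (shift-step p j) , p , inj₁ (refl , refl , refl)
      fromCycle _ _ (j , p , inj₂ (refl , refl)) =
        reverse (step p) , sym (shift-step⁻¹ p j) , p , inj₂ (refl , refl , refl)

      toCycle : ∀ u v → Periodic cycleTable u v → OnCycle u v
      toCycle (i , _) _ (_ , refl , p , inj₁ (refl , refl , refl)) =
        j , p , inj₁ (cong (_, vertex p) (sym i≡) ,
                      cong (_, vertex (sucMod p)) (trans (cong (shift (step p)) (sym i≡)) (shift-step p j)))
        where
          j = shift (reverse (lift (raised p))) i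
          i≡ = reverse-cancelʳ (lift (raised p)) i
      toCycle (i , _) _ (_ , refl , p , inj₂ (refl , refl , refl)) =
        j , p , inj₂ (cong (_, vertex p) (trans (cong (shift (reverse (step p))) (sym i≡)) (shift-step⁻¹ p j)) ,
                      cong (_, vertex (sucMod p)) (sym i≡))
        where
          j = shift (reverse (lift (raised (sucMod p)))) i
          i≡ = reverse-cancelʳ (lift (raised (sucMod p))) i

module _ {A : Set} (partner : A → Shift × A) where

  matchingTable : Table A
  matchingTable s x y = partner x ≡ (s , y)

  matchingTable? : DecidableEquality A → ∀ s x y → Dec (matchingTable s x y)
  matchingTable? _≟_ s x y = ≡-dec _≟ₛ_ _≟_ (partner x) (s , y)

  matching-oneFactor : ∀ {m} → (∀ x s y → partner x ≡ (s , y) → partner y ≡ (reverse s , x)) →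
    OneFactor (Periodic {m} matchingTable)
  matching-oneFactor {m} involutive = symmetric , uniqueNeighbour
    where
      symmetric : ∀ u v → Periodic matchingTable u v → Periodic matchingTable v u
      symmetric (i , x) (_ , y) (s , refl , e) = reverse s , sym (reverse-cancelˡ s i) , involutive x s y e

      uniqueNeighbour : ∀ u → Σ (Fin m × A) λ v → Periodic matchingTable u v × (∀ w → Periodic matchingTable u w → w ≡ v)
      uniqueNeighbour (i , x) = (shift s i , y) , (s , refl , refl) , unique
        where
          s = proj₁ (partner x)
          y = proj₂ (partner x)
          unique : ∀ w → Periodic matchingTable (i , x) w → w ≡ (shift s i , y)
          unique _ (t , refl , e) = cong (λ (t , z) → shift t i , z) (sym e)

graphTable : Table (Fin 8)
graphTable stay x y = InI x y
graphTable up   x y = y ≡ add4 x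
graphTable down x y = y ≡ add4 x

Adj⇔Periodic : ∀ {m} (u v : V m) → Adj m u v ⇔ Periodic graphTable u v
Adj⇔Periodic (i , x) (j , y) = mk⇔ toPeriodic fromPeriodic
  where
    toPeriodic : Adj _ (i , x) (j , y) → Periodic graphTable (i , x) (j , y)
    toPeriodic (inj₁ (e , inj₁ j≡i+1)) = up , j≡i+1 , e
    toPeriodic (inj₁ (e , inj₂ i≡j+1)) = down , trans (sym (predMod-sucMod j)) (cong predMod (sym i≡j+1)) , e
    toPeriodic (inj₂ (i≡j , edge))     = stay , sym i≡j , edge
    fromPeriodic : Periodic graphTable (i , x) (j , y) → Adj _ (i , x) (j , y)
    fromPeriodic (stay , refl , edge) = inj₂ (refl , edge)
    fromPeriodic (up   , refl , e)    = inj₁ (e , inj₁ refl)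
    fromPeriodic (down , refl , e)    = inj₁ (e , inj₂ (sym (sucMod-predMod i)))

graphTable? : ∀ s x y → Dec (graphTable s x y)
graphTable? stay x y = ((toℕ x , toℕ y) ∈? I4 ++ I5 ++ I6) ⊎-dec ((toℕ y , toℕ x) ∈? I4 ++ I5 ++ I6)
  where open Data.List.Membership.DecPropositional (≡-dec _≟ℕ_ _≟ℕ_) using (_∈?_)
graphTable? up   x y = y ≟ᶠ add4 x
graphTable? down x y = y ≟ᶠ add4 x

listedPattern : (vertices positions : Vec (Fin 8) 8) →
  {True (all? λ x → lookup vertices (lookup positions x) ≟ᶠ x)} →
  {True (all? λ p → lookup positions (lookup vertices p) ≟ᶠ p)} →
  CyclePattern 8 (Fin 8)
listedPattern vertices positions {vertex-position} {position-vertex} = record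
  { order  = mk↔ₛ′ (lookup vertices) (lookup positions) (toWitness vertex-position) (toWitness position-vertex)
  ; raised = λ p → 4 ≤ᵇ toℕ p
  }

pattern₁ pattern₂ : CyclePattern 8 (Fin 8)
pattern₁ = listedPattern (# 4 ∷ # 2 ∷ # 7 ∷ # 5 ∷ # 1 ∷ # 3 ∷ # 6 ∷ # 0 ∷ [])
                         (# 7 ∷ # 4 ∷ # 1 ∷ # 5 ∷ # 0 ∷ # 3 ∷ # 6 ∷ # 2 ∷ [])
pattern₂ = listedPattern (# 6 ∷ # 4 ∷ # 1 ∷ # 7 ∷ # 3 ∷ # 5 ∷ # 0 ∷ # 2 ∷ [])
                         (# 6 ∷ # 2 ∷ # 7 ∷ # 4 ∷ # 1 ∷ # 5 ∷ # 0 ∷ # 3 ∷ [])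

partner : Fin 8 → Shift × Fin 8
partner x = (if toℕ x <ᵇ 4 then up else down) , add4 x

partner-involutive : ∀ x s y → partner x ≡ (s , y) → partner y ≡ (reverse s , x)
partner-involutive = from-yes (all? λ x → all-Shift? λ s → all? λ y →
  ≡-dec _≟ₛ_ _≟ᶠ_ (partner x) (s , y) →-dec ≡-dec _≟ₛ_ _≟ᶠ_ (partner y) (reverse s , x))

_⇔-dec_ : {P Q : Set} → Dec P → Dec Q → Dec (P ⇔ Q)
p? ⇔-dec q? = map′ (λ (f , g) → mk⇔ f g) (λ e → Equivalence.to e , Equivalence.from e)
                   ((p? →-dec q?) ×-dec (q? →-dec p?))

disjoint? : ∀ {n} {R₁ R₂ : Table (Fin n)} → (∀ s x y → Dec (R₁ s x y)) → (∀ s x y → Dec (R₂ s x y)) →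
  Dec (∀ s x y → ¬ (R₁ s x y × R₂ s x y))
disjoint? R₁? R₂? = all-Shift? λ s → all? λ x → all? λ y → ¬? (R₁? s x y ×-dec R₂? s x y)

cycle₁? : ∀ s x y → Dec (cycleTable pattern₁ s x y)
cycle₁? = cycleTable? pattern₁ _≟ᶠ_

cycle₂? : ∀ s x y → Dec (cycleTable pattern₂ s x y)
cycle₂? = cycleTable? pattern₂ _≟ᶠ_

matching? : ∀ s x y → Dec (matchingTable partner s x y)
matching? = matchingTable? partner _≟ᶠ_

graph-partition : ∀ s x y →
  graphTable s x y ⇔ (cycleTable pattern₁ s x y ⊎ cycleTable pattern₂ s x y ⊎ matchingTable partner s x y)
graph-partition = from-yes (all-Shift? λ s → all? λ x → all? λ y →
  graphTable? s x y ⇔-dec (cycle₁? s x y ⊎-dec cycle₂? s x y ⊎-dec matching? s x y))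

lemma2p13 : (m : ℕ) → 3 ≤ m →
    Σ (V m → V m → Set) λ F₁ → Σ (V m → V m → Set) λ F₂ → Σ (V m → V m → Set) λ M →
      CFactor 8 F₁ × CFactor 8 F₂ × OneFactor M × EdgePartition (Adj m) F₁ F₂ M
lemma2p13 (suc (suc (suc k))) (s≤s (s≤s (s≤s z≤n))) =
  Periodic (cycleTable pattern₁) , Periodic (cycleTable pattern₂) , Periodic (matchingTable partner) ,
  cycle-factor pattern₁ , cycle-factor pattern₂ , matching-oneFactor partner partner-involutive ,
  λ u v → Periodic-partition graph-partition u v ⇔-∘ Adj⇔Periodic u v
        , Periodic-disjoint (from-yes (disjoint? cycle₁? cycle₂?)) u v
        , Periodic-disjoint (from-yes (disjoint? cycle₁? matching?)) u v
        , Periodic-disjoint (from-yes (disjoint? cycle₂? matching?)) u v
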